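{- Let $P$ be a path with vertices $v_1,\dots,v_n$ in this order, where $n$ is odd, and let $L$ be a list assignment on $P$. Then for any sets of colours $p,q$, \[ S_{L^{p,q}}(P) = S_L(P) - \Big(|(A\cup \hat X_1)\cap p| + |(A\cup \hat X_n)\cap q| - |A\cap p\cap q|\Big). \]
   Context: For a list assignment $L$ on the path $P=v_1\cdots v_n$: $X_1=L(v_1)$, $X_i=L(v_i)\setminus X_{i-1}$ for $i>1$, and $S_L(P)=\sum_{i=1}^n|X_i|$. Let $A=\bigcap_{i=1}^n L(v_i)$. For $c\in L(v_1)\setminus A$ let $f(c)=\min\{i : c\notin L(v_i)\}$; define $\hat X_1=\{c\in L(v_1)\setminus A : f(c)\text{ is even}\}$ and $\hat X_n = X_n\setminus A$. For colour sets $p,q$, $L^{p,q}$ denotes the list assignment obtained from $L$ by deleting all colours of $p$ from $L(v_1)$ and all colours of $q$ from $L(v_n)$, leaving all other lists unchanged (if $n=1$, both deletions are made from $L(v_1)$). -}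

module Defs where

open import Data.Bool using (Bool; true; false; if_then_else_; _∧_; not)
open import Data.Nat using (ℕ; zero; suc; _+_; _%_)
open import Data.Fin using (Fin)
open import Data.Fin.Subset using (Subset; _∩_; _∪_; _─_; ∣_∣; ⊤; ⊥)
open import Data.List using (List; []; _∷_; length)
open import Data.Maybe using (Maybe; just; nothing)
open import Data.Vec using (lookup; tabulate)

-- Colours are drawn from Fin k; a colour set is a Subset k.
-- A list assignment on the path P = v₁ ⋯ vₙ is the list [L(v₁), …, L(vₙ)].
ListAssignment : ℕ → Set
ListAssignment k = List (Subset k)

Xs-from : ∀ {k} → Subset k → List (Subset k) → List (Subset k)
Xs-from prev []       = []
Xs-from prev (S ∷ Ls) = let X = S ─ prev in X ∷ Xs-from X Ls

Xs : ∀ {k} → ListAssignment k → List (Subset k)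
Xs L = Xs-from ⊥ L

sumCard : ∀ {k} → List (Subset k) → ℕ
sumCard []       = 0
sumCard (X ∷ Xs) = ∣ X ∣ + sumCard Xs

S : ∀ {k} → ListAssignment k → ℕ
S L = sumCard (Xs L)

A : ∀ {k} → ListAssignment k → Subset k
A []       = ⊤
A (S ∷ Ls) = S ∩ A Ls

-- last element of a list (Xₙ etc.); ∅ for the empty list (never used: n odd)
lastOr⊥ : ∀ {k} → List (Subset k) → Subset k
lastOr⊥ []           = ⊥
lastOr⊥ (X ∷ [])     = X
lastOr⊥ (X ∷ Y ∷ Ys) = lastOr⊥ (Y ∷ Ys)

headOr⊥ : ∀ {k} → List (Subset k) → Subset k
headOr⊥ []       = ⊥
headOr⊥ (X ∷ _)  = X

-- f(c) = min { i : c ∉ L(vᵢ) }  (1-based), nothing if c lies in every list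
firstOut : ∀ {k} → Fin k → ListAssignment k → Maybe ℕ
firstOut c []       = nothing
firstOut c (S ∷ Ls) with lookup S c
... | true  = Data.Maybe.map suc (firstOut c Ls)
... | false = just 1

isEven : ℕ → Bool
isEven zero          = true
isEven (suc zero)    = false
isEven (suc (suc n)) = isEven n

evenJust : Maybe ℕ → Bool
evenJust nothing  = false
evenJust (just i) = isEven i

hatX₁ : ∀ {k} → ListAssignment k → Subset k
hatX₁ L = tabulate (λ c → lookup (headOr⊥ L ─ A L) c ∧ evenJust (firstOut c L))

hatXₙ : ∀ {k} → ListAssignment k → Subset k
hatXₙ L = lastOr⊥ (Xs L) ─ A L

-- L^{p,q}: delete p from L(v₁) and q from L(vₙ) (both from L(v₁) if n = 1)
deleteLast : ∀ {k} → Subset k → List (Subset k) → List (Subset k)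
deleteLast q []           = []
deleteLast q (X ∷ [])     = (X ─ q) ∷ []
deleteLast q (X ∷ Y ∷ Ys) = X ∷ deleteLast q (Y ∷ Ys)

deleteFirst : ∀ {k} → Subset k → List (Subset k) → List (Subset k)
deleteFirst p []       = []
deleteFirst p (X ∷ Xs) = (X ─ p) ∷ Xs

L[_,_] : ∀ {k} → ListAssignment k → Subset k → Subset k → ListAssignment k
L[ L , p ] q = deleteLast q (deleteFirst p L)

-- Every quantity in the identity is a sum over colours, so it suffices to
-- prove it for a single colour c, given by the bits [c ∈ L(vᵢ)]. Along a
-- maximal run of lists containing c, membership of c in Xᵢ alternates 1,0,1,….
-- Deleting c from L(v₁) shortens the first run by one, which lowers the count
-- exactly when that run has odd length; its length is f(c) − 1, or n when
-- c ∈ A, so this happens exactly for c ∈ A ∪ X̂₁. Deleting c from L(vₙ) lowers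
-- the count exactly when c ∈ Xₙ, and Xₙ = A ∪ X̂ₙ because n is odd. The two
-- deletions interfere only when the whole path is one run, i.e. c ∈ A: after
-- the first, the run has even length and c ∉ Xₙ, so together they lower the
-- count by one rather than two, which is the correction |A ∩ p ∩ q|.
module Submission where

open import Defs
open import Algebra.Properties.CommutativeSemigroup using (interchange)
open import Data.Bool using (Bool; true; false; _∧_; _∨_; not; _xor_)
open import Data.Bool.Properties using (∧-comm; ∧-zeroʳ; ∧-identityʳ; not-involutive; not-injective)
open import Data.Fin using (Fin; zero; suc)
open import Data.Fin.Subset using (Subset; _∩_; _∪_; _─_; ∣_∣; ⊥)
open import Data.Bool.ListAction using (and)
open import Data.List using (List; []; _∷_; length; map)
open import Data.Maybe using (Maybe; just; nothing; maybe; is-nothing)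
import Data.Maybe as Maybe
open import Data.Nat using (ℕ; zero; suc; _+_; _%_)
open import Data.Nat.Properties using (+-assoc; +-comm; +-identityʳ; +-commutativeSemigroup)
open import Data.Nat.Tactic.RingSolver using (solve-∀)
open import Data.Vec using ([]; _∷_; head; tail; lookup)
open import Data.Vec.Properties using (tabulate-cong)
open import Relation.Binary.PropositionalEquality
  using (_≡_; refl; sym; trans; cong; cong₂; module ≡-Reasoning)

open ≡-Reasoning

+-interchange : ∀ w x y z → (w + x) + (y + z) ≡ (w + y) + (x + z)
+-interchange = interchange +-commutativeSemigroup

+-combine : ∀ {s₀ s x₀ x y₀ y t₀ t z₀ z} →
  s₀ + (x₀ + y₀) ≡ t₀ + z₀ → s + (x + y) ≡ t + z →
  (s₀ + s) + ((x₀ + x) + (y₀ + y)) ≡ (t₀ + t) + (z₀ + z)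
+-combine {s₀} {s} {x₀} {x} {y₀} {y} {t₀} {t} {z₀} {z} e₀ e = begin
  (s₀ + s) + ((x₀ + x) + (y₀ + y)) ≡⟨ regroup s₀ s x₀ x y₀ y ⟩
  (s₀ + (x₀ + y₀)) + (s + (x + y)) ≡⟨ cong₂ _+_ e₀ e ⟩
  (t₀ + z₀) + (t + z)               ≡⟨ +-interchange t₀ z₀ t z ⟩
  (t₀ + t) + (z₀ + z)               ∎
  where
  regroup : ∀ s₀ s x₀ x y₀ y → (s₀ + s) + ((x₀ + x) + (y₀ + y)) ≡ (s₀ + (x₀ + y₀)) + (s + (x + y))
  regroup = solve-∀

+-rearrange : ∀ s x y z → s + (x + (y + z)) ≡ s + y + x + z
+-rearrange = solve-∀

bit : Bool → ℕ
bit true  = 1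
bit false = 0

-- Same clauses as the (private) difference used by Subset's _─_.
diff : Bool → Bool → Bool
diff x true  = false
diff x false = x

lastOr : ∀ {A : Set} → A → List A → A
lastOr d []       = d
lastOr d (x ∷ xs) = lastOr x xs

headOr : ∀ {A : Set} → A → List A → A
headOr d []      = d
headOr d (x ∷ _) = x

oddLength : ∀ {A : Set} → List A → Bool
oddLength []       = false
oddLength (_ ∷ xs) = not (oddLength xs)

oddLength-map : ∀ {A B : Set} (f : A → B) (xs : List A) → oddLength (map f xs) ≡ oddLength xs
oddLength-map f []       = refl
oddLength-map f (x ∷ xs) = cong not (oddLength-map f xs)

length%2≡1⇒oddLength : ∀ {A : Set} (xs : List A) → length xs % 2 ≡ 1 → oddLength xs ≡ true
length%2≡1⇒oddLength (x ∷ [])     _ = refl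
length%2≡1⇒oddLength (x ∷ y ∷ xs) h = trans (not-involutive (oddLength xs)) (length%2≡1⇒oddLength xs h)

isEven-suc : ∀ i → isEven (suc i) ≡ not (isEven i)
isEven-suc zero          = refl
isEven-suc (suc zero)    = refl
isEven-suc (suc (suc i)) = isEven-suc i

-- A single colour: its membership pattern bs along the path, bsᵢ = (c ∈ L(vᵢ)).

Xsᵇ-from : Bool → List Bool → List Bool
Xsᵇ-from prev []       = []
Xsᵇ-from prev (b ∷ bs) = diff b prev ∷ Xsᵇ-from (diff b prev) bs

Sᵇ-from : Bool → List Bool → ℕ
Sᵇ-from prev []       = 0
Sᵇ-from prev (b ∷ bs) = bit (diff b prev) + Sᵇ-from (diff b prev) bs

Sᵇ : List Bool → ℕ
Sᵇ = Sᵇ-from false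

lastXᵇ : List Bool → Bool
lastXᵇ bs = lastOr false (Xsᵇ-from false bs)

firstOutᵇ : List Bool → Maybe ℕ
firstOutᵇ []           = nothing
firstOutᵇ (true  ∷ bs) = Maybe.map suc (firstOutᵇ bs)
firstOutᵇ (false ∷ bs) = just 1

hatX₁ᵇ : List Bool → Bool
hatX₁ᵇ bs = diff (headOr false bs) (and bs) ∧ evenJust (firstOutᵇ bs)

hatXₙᵇ : List Bool → Bool
hatXₙᵇ bs = diff (lastXᵇ bs) (and bs)

deleteFirstᵇ : Bool → List Bool → List Bool
deleteFirstᵇ a []       = []
deleteFirstᵇ a (x ∷ xs) = diff x a ∷ xs

deleteLastᵇ : Bool → List Bool → List Bool
deleteLastᵇ b []           = []
deleteLastᵇ b (x ∷ [])     = diff x b ∷ []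
deleteLastᵇ b (x ∷ y ∷ ys) = x ∷ deleteLastᵇ b (y ∷ ys)

firstRunOdd : List Bool → Bool
firstRunOdd []           = false
firstRunOdd (false ∷ bs) = false
firstRunOdd (true  ∷ bs) = not (firstRunOdd bs)

-- Starting a run with c ∈ X₀ instead of c ∉ X₀ flips its alternating pattern.
Sᵇ-from-false : ∀ bs → Sᵇ-from false bs ≡ bit (firstRunOdd bs) + Sᵇ-from true bs
Sᵇ-from-false []           = refl
Sᵇ-from-false (false ∷ bs) = refl
Sᵇ-from-false (true  ∷ bs) rewrite Sᵇ-from-false bs with firstRunOdd bs
... | true  = refl
... | false = refl

Sᵇ-deleteFirstᵇ : ∀ a bs → Sᵇ (deleteFirstᵇ a bs) + bit (a ∧ firstRunOdd bs) ≡ Sᵇ bs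
Sᵇ-deleteFirstᵇ false []           = refl
Sᵇ-deleteFirstᵇ true  []           = refl
Sᵇ-deleteFirstᵇ false (x ∷ bs)     = +-identityʳ _
Sᵇ-deleteFirstᵇ true  (false ∷ bs) = +-identityʳ _
Sᵇ-deleteFirstᵇ true  (true  ∷ bs) rewrite Sᵇ-from-false bs with firstRunOdd bs
... | true  = +-identityʳ _
... | false = +-comm (Sᵇ-from true bs) 1

Sᵇ-from-deleteLastᵇ : ∀ b prev bs →
  Sᵇ-from prev (deleteLastᵇ b bs) + bit (b ∧ lastOr false (Xsᵇ-from prev bs)) ≡ Sᵇ-from prev bs
Sᵇ-from-deleteLastᵇ false prev  []          = refl
Sᵇ-from-deleteLastᵇ true  prev  []          = refl
Sᵇ-from-deleteLastᵇ true  true  (x ∷ [])    = refl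
Sᵇ-from-deleteLastᵇ false true  (x ∷ [])    = refl
Sᵇ-from-deleteLastᵇ true  false (true  ∷ []) = refl
Sᵇ-from-deleteLastᵇ true  false (false ∷ []) = refl
Sᵇ-from-deleteLastᵇ false false (true  ∷ []) = refl
Sᵇ-from-deleteLastᵇ false false (false ∷ []) = refl
Sᵇ-from-deleteLastᵇ b prev (x ∷ y ∷ bs) =
  trans (+-assoc (bit (diff x prev)) _ _)
    (cong (bit (diff x prev) +_) (Sᵇ-from-deleteLastᵇ b (diff x prev) (y ∷ bs)))

lastOr-Xsᵇ-from-all : ∀ x bs → and bs ≡ true → lastOr x (Xsᵇ-from x bs) ≡ x xor oddLength bs
lastOr-Xsᵇ-from-all false []          _ = refl
lastOr-Xsᵇ-from-all true  []          _ = refl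
lastOr-Xsᵇ-from-all x     (true ∷ bs) h with x
... | true  = trans (lastOr-Xsᵇ-from-all false bs h) (sym (not-involutive (oddLength bs)))
... | false = lastOr-Xsᵇ-from-all true bs h

-- Past the first colour-free list the X's no longer depend on X₀.
lastOr-Xsᵇ-from-notAll : ∀ x y bs → and bs ≡ false →
  lastOr x (Xsᵇ-from x bs) ≡ lastOr y (Xsᵇ-from y bs)
lastOr-Xsᵇ-from-notAll true  true  (false ∷ bs) _ = refl
lastOr-Xsᵇ-from-notAll true  false (false ∷ bs) _ = refl
lastOr-Xsᵇ-from-notAll false true  (false ∷ bs) _ = refl
lastOr-Xsᵇ-from-notAll false false (false ∷ bs) _ = refl
lastOr-Xsᵇ-from-notAll x     y     (true  ∷ bs) h =
  lastOr-Xsᵇ-from-notAll (diff true x) (diff true y) bs h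

lastXᵇ-all : ∀ bs → oddLength bs ≡ true → and bs ≡ true → lastXᵇ bs ≡ true
lastXᵇ-all bs odd all = trans (lastOr-Xsᵇ-from-all false bs all) odd

lastXᵇ-deleteFirstᵇ : ∀ a bs → oddLength bs ≡ true →
  lastXᵇ (deleteFirstᵇ a bs) ≡ lastXᵇ bs ∧ not (a ∧ and bs)
lastXᵇ-deleteFirstᵇ a (c ∷ bs) odd with and bs in all
... | true rewrite lastOr-Xsᵇ-from-all (diff c a) bs all | lastOr-Xsᵇ-from-all c bs all
                 | not-injective {y = false} odd with a | c
...   | true  | true  = refl
...   | true  | false = refl
...   | false | true  = refl
...   | false | false = refl
lastXᵇ-deleteFirstᵇ a (c ∷ bs) odd | false
  rewrite lastOr-Xsᵇ-from-notAll (diff c a) c bs all | ∧-zeroʳ c | ∧-zeroʳ a =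
  sym (∧-identityʳ _)

firstRunOdd≡ : ∀ bs → firstRunOdd bs ≡ maybe isEven (oddLength bs) (firstOutᵇ bs)
firstRunOdd≡ []           = refl
firstRunOdd≡ (false ∷ bs) = refl
firstRunOdd≡ (true  ∷ bs) rewrite firstRunOdd≡ bs with firstOutᵇ bs
... | nothing = refl
... | just i  = sym (isEven-suc i)

and≡is-nothing-firstOutᵇ : ∀ bs → and bs ≡ is-nothing (firstOutᵇ bs)
and≡is-nothing-firstOutᵇ []           = refl
and≡is-nothing-firstOutᵇ (false ∷ bs) = refl
and≡is-nothing-firstOutᵇ (true  ∷ bs) rewrite and≡is-nothing-firstOutᵇ bs with firstOutᵇ bs
... | nothing = refl
... | just i  = refl

A∪hatX₁ᵇ≡firstRunOdd : ∀ bs → oddLength bs ≡ true → and bs ∨ hatX₁ᵇ bs ≡ firstRunOdd bs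
A∪hatX₁ᵇ≡firstRunOdd (false ∷ bs) _ = refl
A∪hatX₁ᵇ≡firstRunOdd (true  ∷ bs) odd
  rewrite and≡is-nothing-firstOutᵇ bs | firstRunOdd≡ bs with firstOutᵇ bs
... | nothing = sym odd
... | just i  = isEven-suc i

A∪hatXₙᵇ≡lastXᵇ : ∀ bs → oddLength bs ≡ true → and bs ∨ hatXₙᵇ bs ≡ lastXᵇ bs
A∪hatXₙᵇ≡lastXᵇ bs odd with and bs in all
... | true  = sym (lastXᵇ-all bs odd all)
... | false = refl

bit-∧-split : ∀ α ℓ a b → (α ≡ true → ℓ ≡ true) →
  bit (ℓ ∧ b) ≡ bit (b ∧ (ℓ ∧ not (a ∧ α))) + bit (α ∧ (a ∧ b))
bit-∧-split true  false a     b     h with () ← h refl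
bit-∧-split true  true  true  true  _ = refl
bit-∧-split true  true  true  false _ = refl
bit-∧-split true  true  false true  _ = refl
bit-∧-split true  true  false false _ = refl
bit-∧-split false ℓ     a     b     _ rewrite ∧-zeroʳ a | ∧-identityʳ ℓ | ∧-comm ℓ b =
  sym (+-identityʳ _)

colour-identity : ∀ bs → oddLength bs ≡ true → ∀ a b →
  Sᵇ (deleteLastᵇ b (deleteFirstᵇ a bs))
    + (bit ((and bs ∨ hatX₁ᵇ bs) ∧ a) + bit ((and bs ∨ hatXₙᵇ bs) ∧ b))
    ≡ Sᵇ bs + bit (and bs ∧ (a ∧ b))
colour-identity bs odd a b
  rewrite A∪hatX₁ᵇ≡firstRunOdd bs odd | A∪hatXₙᵇ≡lastXᵇ bs odd = begin
    s″ + (bit (g ∧ a) + bit (ℓ ∧ b))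
      ≡⟨ cong₂ (λ x y → s″ + (bit x + y)) (∧-comm g a)
           (bit-∧-split α ℓ a b (lastXᵇ-all bs odd)) ⟩
    s″ + (bit (a ∧ g) + (bit (b ∧ (ℓ ∧ not (a ∧ α))) + bit (α ∧ (a ∧ b))))
      ≡⟨ +-rearrange s″ _ _ _ ⟩
    s″ + bit (b ∧ (ℓ ∧ not (a ∧ α))) + bit (a ∧ g) + bit (α ∧ (a ∧ b))
      ≡⟨ cong (λ ℓ′ → s″ + bit (b ∧ ℓ′) + bit (a ∧ g) + bit (α ∧ (a ∧ b)))
           (sym (lastXᵇ-deleteFirstᵇ a bs odd)) ⟩
    s″ + bit (b ∧ lastXᵇ (deleteFirstᵇ a bs)) + bit (a ∧ g) + bit (α ∧ (a ∧ b))
      ≡⟨ cong (λ s → s + bit (a ∧ g) + bit (α ∧ (a ∧ b)))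
           (Sᵇ-from-deleteLastᵇ b false (deleteFirstᵇ a bs)) ⟩
    Sᵇ (deleteFirstᵇ a bs) + bit (a ∧ g) + bit (α ∧ (a ∧ b))
      ≡⟨ cong (_+ bit (α ∧ (a ∧ b))) (Sᵇ-deleteFirstᵇ a bs) ⟩
    Sᵇ bs + bit (α ∧ (a ∧ b))
      ∎
  where
  s″ = Sᵇ (deleteLastᵇ b (deleteFirstᵇ a bs))
  α  = and bs
  g  = firstRunOdd bs
  ℓ  = lastXᵇ bs

-- Splitting off colour zero: a list assignment over Fin (suc k) is its first
-- column (map head) together with a list assignment over Fin k (map tail).

─-∷ : ∀ {k} x y (xs ys : Subset k) → (x ∷ xs) ─ (y ∷ ys) ≡ diff x y ∷ (xs ─ ys)
─-∷ x true  xs ys = refl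
─-∷ x false xs ys = refl

∣∷∣ : ∀ {k} b (v : Subset k) → ∣ b ∷ v ∣ ≡ bit b + ∣ v ∣
∣∷∣ true  v = refl
∣∷∣ false v = refl

sumCard-Xs-from-columns : ∀ {k} x (prev : Subset k) L →
  sumCard (Xs-from (x ∷ prev) L) ≡ Sᵇ-from x (map head L) + sumCard (Xs-from prev (map tail L))
sumCard-Xs-from-columns x prev []              = refl
sumCard-Xs-from-columns x prev ((y ∷ ys) ∷ L) = begin
  ∣ (y ∷ ys) ─ (x ∷ prev) ∣ + sumCard (Xs-from ((y ∷ ys) ─ (x ∷ prev)) L)
    ≡⟨ cong (λ X → ∣ X ∣ + sumCard (Xs-from X L)) (─-∷ y x ys prev) ⟩
  ∣ diff y x ∷ (ys ─ prev) ∣ + sumCard (Xs-from (diff y x ∷ (ys ─ prev)) L)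
    ≡⟨ cong₂ _+_ (∣∷∣ (diff y x) (ys ─ prev)) (sumCard-Xs-from-columns (diff y x) (ys ─ prev) L) ⟩
  (bit (diff y x) + ∣ ys ─ prev ∣)
    + (Sᵇ-from (diff y x) (map head L) + sumCard (Xs-from (ys ─ prev) (map tail L)))
    ≡⟨ +-interchange (bit (diff y x)) ∣ ys ─ prev ∣ _ _ ⟩
  Sᵇ-from x (y ∷ map head L) + sumCard (Xs-from prev (ys ∷ map tail L))
    ∎

S-columns : ∀ {k} (L : ListAssignment (suc k)) → S L ≡ Sᵇ (map head L) + S (map tail L)
S-columns = sumCard-Xs-from-columns false ⊥

A-columns : ∀ {k} (L : ListAssignment (suc k)) → A L ≡ and (map head L) ∷ A (map tail L)
A-columns []              = refl
A-columns ((y ∷ ys) ∷ L) rewrite A-columns L = refl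

lastOr⊥-Xs-from-columns : ∀ {k} x (prev : Subset k) L →
  lastOr⊥ (Xs-from (x ∷ prev) L)
    ≡ lastOr false (Xsᵇ-from x (map head L)) ∷ lastOr⊥ (Xs-from prev (map tail L))
lastOr⊥-Xs-from-columns x prev []                             = refl
lastOr⊥-Xs-from-columns x prev ((y ∷ ys) ∷ [])                 = ─-∷ y x ys prev
lastOr⊥-Xs-from-columns x prev ((y ∷ ys) ∷ (z ∷ zs) ∷ L) =
  trans (cong (λ X → lastOr⊥ (Xs-from X ((z ∷ zs) ∷ L))) (─-∷ y x ys prev))
    (lastOr⊥-Xs-from-columns (diff y x) (ys ─ prev) ((z ∷ zs) ∷ L))

firstOut-zero : ∀ {k} (L : ListAssignment (suc k)) → firstOut zero L ≡ firstOutᵇ (map head L)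
firstOut-zero []                  = refl
firstOut-zero ((true  ∷ ys) ∷ L) = cong (Maybe.map suc) (firstOut-zero L)
firstOut-zero ((false ∷ ys) ∷ L) = refl

firstOut-suc : ∀ {k} (c : Fin k) (L : ListAssignment (suc k)) →
  firstOut (suc c) L ≡ firstOut c (map tail L)
firstOut-suc c []              = refl
firstOut-suc c ((y ∷ ys) ∷ L) with lookup ys c
... | true  = cong (Maybe.map suc) (firstOut-suc c L)
... | false = refl

hatX₁-columns : ∀ {k} (L : ListAssignment (suc k)) → hatX₁ L ≡ hatX₁ᵇ (map head L) ∷ hatX₁ (map tail L)
hatX₁-columns L = cong₂ _∷_
  (cong₂ _∧_ (cong (λ v → lookup v zero) first∖A) (cong evenJust (firstOut-zero L)))
  (tabulate-cong λ c →
    cong₂ _∧_ (cong (λ v → lookup v (suc c)) first∖A) (cong evenJust (firstOut-suc c L)))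
  where
  headOr⊥-columns : ∀ {k} (L : ListAssignment (suc k)) →
    headOr⊥ L ≡ headOr false (map head L) ∷ headOr⊥ (map tail L)
  headOr⊥-columns []              = refl
  headOr⊥-columns ((y ∷ ys) ∷ L) = refl

  first∖A : headOr⊥ L ─ A L
    ≡ diff (headOr false (map head L)) (and (map head L)) ∷ (headOr⊥ (map tail L) ─ A (map tail L))
  first∖A = trans (cong₂ _─_ (headOr⊥-columns L) (A-columns L))
    (─-∷ (headOr false (map head L)) (and (map head L)) _ _)

hatXₙ-columns : ∀ {k} (L : ListAssignment (suc k)) → hatXₙ L ≡ hatXₙᵇ (map head L) ∷ hatXₙ (map tail L)
hatXₙ-columns L =
  trans (cong₂ _─_ (lastOr⊥-Xs-from-columns false ⊥ L) (A-columns L))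
    (─-∷ (lastXᵇ (map head L)) (and (map head L)) _ _)

deleteFirst-heads : ∀ {k} a (p : Subset k) L →
  map head (deleteFirst (a ∷ p) L) ≡ deleteFirstᵇ a (map head L)
deleteFirst-heads a p []              = refl
deleteFirst-heads a p ((y ∷ ys) ∷ L) = cong (λ X → map head (X ∷ L)) (─-∷ y a ys p)

deleteFirst-tails : ∀ {k} a (p : Subset k) L →
  map tail (deleteFirst (a ∷ p) L) ≡ deleteFirst p (map tail L)
deleteFirst-tails a p []              = refl
deleteFirst-tails a p ((y ∷ ys) ∷ L) = cong (λ X → map tail (X ∷ L)) (─-∷ y a ys p)

deleteLast-heads : ∀ {k} b (q : Subset k) L →
  map head (deleteLast (b ∷ q) L) ≡ deleteLastᵇ b (map head L)
deleteLast-heads b q []                         = refl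
deleteLast-heads b q ((y ∷ ys) ∷ [])            = cong (λ X → map head (X ∷ [])) (─-∷ y b ys q)
deleteLast-heads b q ((y ∷ ys) ∷ (z ∷ zs) ∷ L) = cong (y ∷_) (deleteLast-heads b q ((z ∷ zs) ∷ L))

deleteLast-tails : ∀ {k} b (q : Subset k) L →
  map tail (deleteLast (b ∷ q) L) ≡ deleteLast q (map tail L)
deleteLast-tails b q []                         = refl
deleteLast-tails b q ((y ∷ ys) ∷ [])            = cong (λ X → map tail (X ∷ [])) (─-∷ y b ys q)
deleteLast-tails b q ((y ∷ ys) ∷ (z ∷ zs) ∷ L) = cong (ys ∷_) (deleteLast-tails b q ((z ∷ zs) ∷ L))

S-L[]-columns : ∀ {k} (L : ListAssignment (suc k)) a p b q →
  S (L[ L , a ∷ p ] (b ∷ q))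
    ≡ Sᵇ (deleteLastᵇ b (deleteFirstᵇ a (map head L))) + S (L[ map tail L , p ] q)
S-L[]-columns L a p b q
  rewrite S-columns (L[ L , a ∷ p ] (b ∷ q))
        | deleteLast-heads b q (deleteFirst (a ∷ p) L) | deleteFirst-heads a p L
        | deleteLast-tails b q (deleteFirst (a ∷ p) L) | deleteFirst-tails a p L = refl

∣∣-Subset0 : (v : Subset 0) → ∣ v ∣ ≡ 0
∣∣-Subset0 [] = refl

sumCard-Subset0 : (Xs : List (Subset 0)) → sumCard Xs ≡ 0
sumCard-Subset0 []       = refl
sumCard-Subset0 (X ∷ Xs) rewrite ∣∣-Subset0 X = sumCard-Subset0 Xs

deletion-identity : ∀ k (L : ListAssignment k) → oddLength L ≡ true → (p q : Subset k) →
  S (L[ L , p ] q) + (∣ (A L ∪ hatX₁ L) ∩ p ∣ + ∣ (A L ∪ hatXₙ L) ∩ q ∣)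
    ≡ S L + ∣ A L ∩ p ∩ q ∣
deletion-identity zero L _ p q
  rewrite ∣∣-Subset0 ((A L ∪ hatX₁ L) ∩ p) | ∣∣-Subset0 ((A L ∪ hatXₙ L) ∩ q)
        | ∣∣-Subset0 (A L ∩ p ∩ q) | sumCard-Subset0 (Xs (L[ L , p ] q)) | sumCard-Subset0 (Xs L) = refl
deletion-identity (suc k) L odd (a ∷ p) (b ∷ q) = begin
  S (L[ L , a ∷ p ] (b ∷ q))
    + (∣ (A L ∪ hatX₁ L) ∩ (a ∷ p) ∣ + ∣ (A L ∪ hatXₙ L) ∩ (b ∷ q) ∣)
    ≡⟨ cong₂ _+_ (S-L[]-columns L a p b q) (cong₂ _+_ ∣P∣ ∣Q∣) ⟩
  (s₀ + s) + ((x₀ + x) + (y₀ + y))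
    ≡⟨ +-combine {s₀} {s} {x₀} {x} {y₀} {y} {Sᵇ hs} {S ts}
        (colour-identity hs (trans (oddLength-map head L) odd) a b)
        (deletion-identity k ts (trans (oddLength-map tail L) odd) p q) ⟩
  (Sᵇ hs + S ts) + (bit (α ∧ (a ∧ b)) + ∣ A ts ∩ p ∩ q ∣)
    ≡⟨ sym (cong₂ _+_ (S-columns L) ∣R∣) ⟩
  S L + ∣ A L ∩ (a ∷ p) ∩ (b ∷ q) ∣
    ∎
  where
  hs = map head L
  ts = map tail L
  α  = and hs
  s₀ = Sᵇ (deleteLastᵇ b (deleteFirstᵇ a hs))
  s  = S (L[ ts , p ] q)
  x₀ = bit ((α ∨ hatX₁ᵇ hs) ∧ a)
  x  = ∣ (A ts ∪ hatX₁ ts) ∩ p ∣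
  y₀ = bit ((α ∨ hatXₙᵇ hs) ∧ b)
  y  = ∣ (A ts ∪ hatXₙ ts) ∩ q ∣

  ∣P∣ : ∣ (A L ∪ hatX₁ L) ∩ (a ∷ p) ∣ ≡ x₀ + x
  ∣P∣ = trans (cong₂ (λ u v → ∣ (u ∪ v) ∩ (a ∷ p) ∣) (A-columns L) (hatX₁-columns L))
    (∣∷∣ ((α ∨ hatX₁ᵇ hs) ∧ a) ((A ts ∪ hatX₁ ts) ∩ p))

  ∣Q∣ : ∣ (A L ∪ hatXₙ L) ∩ (b ∷ q) ∣ ≡ y₀ + y
  ∣Q∣ = trans (cong₂ (λ u v → ∣ (u ∪ v) ∩ (b ∷ q) ∣) (A-columns L) (hatXₙ-columns L))
    (∣∷∣ ((α ∨ hatXₙᵇ hs) ∧ b) ((A ts ∪ hatXₙ ts) ∩ q))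

  ∣R∣ : ∣ A L ∩ (a ∷ p) ∩ (b ∷ q) ∣ ≡ bit (α ∧ (a ∧ b)) + ∣ A ts ∩ p ∩ q ∣
  ∣R∣ = trans (cong (λ u → ∣ u ∩ (a ∷ p) ∩ (b ∷ q) ∣) (A-columns L))
    (∣∷∣ (α ∧ (a ∧ b)) (A ts ∩ p ∩ q))

lemma2p4 : (k : ℕ) (L : ListAssignment k) → length L % 2 ≡ 1 →
    (p q : Subset k) →
    S (L[ L , p ] q) + (∣ (A L ∪ hatX₁ L) ∩ p ∣ + ∣ (A L ∪ hatXₙ L) ∩ q ∣)
      ≡ S L + ∣ A L ∩ p ∩ q ∣
lemma2p4 k L n-odd = deletion-identity k L (length%2≡1⇒oddLength L n-odd)
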